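{- Let $G_1,G_2$ be finite connected simple graphs, $x_1\in V(G_1)$, $x_2\in V(G_2)$, and let $G=G_1[x_1]\oplus G_2[x_2]$ be their $1$-sum. Suppose that for some eigenvalue $\lambda$ of the normalized Laplacian of $G_1$ there is a corresponding eigenfunction $f^1:V(G_1)\to\mathbb{R}$ with $f^1(x_1)=0$. Then $f^1\oplus_{x_1,x_2}\mathbf{0}^2$ is an eigenfunction of the normalized Laplacian of $G$ with eigenvalue $\lambda$, where $\mathbf{0}^2$ is the zero function on $V(G_2)$.
   Context: The $1$-sum $G_1[x_1]\oplus G_2[x_2]$ is obtained from the disjoint union of $G_1$ and $G_2$ by identifying $x_1$ and $x_2$ into a single new vertex $y$. We identify $G_1$ (resp. $G_2$) with the induced subgraph on $(V(G_1)\setminus\{x_1\})\cup\{y\}$ (resp. $(V(G_2)\setminus\{x_2\})\cup\{y\}$), with $y$ playing the role of $x_1$ (resp. $x_2$). For $f^1,f^2$ with $f^1(x_1)=f^2(x_2)$, $f^1\oplus_{x_1,x_2}f^2$ is the function on $V(G)$ whose restriction to $G_1$ is $f^1$ and to $G_2$ is $f^2$. The normalized Laplacian acts by $Lf(v)=f(v)-\frac1{\deg v}\sum_{w\sim v}f(w)$. -}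

module Defs where

open import Level using (Level; _⊔_) renaming (suc to lsuc)
open import Data.Nat using (ℕ; zero; suc) renaming (_+_ to _+ℕ_)
open import Data.Fin using (Fin; zero; suc; _↑ˡ_; _↑ʳ_; splitAt; punchIn; _≟_)
open import Data.Bool using (Bool; true; false; if_then_else_; T)
open import Data.Sum using (_⊎_; inj₁; inj₂)
open import Data.Product using (Σ; ∃; _×_; _,_)
open import Relation.Nullary using (¬_; yes; no)
open import Relation.Binary.PropositionalEquality using (_≡_)
open import Algebra.Bundles using (CommutativeRing)

-- Scalars: a field of characteristic zero (stand-in for ℝ).
-- The inverse is a total function; only its value on nonzero elements
-- is constrained.

ringFromℕ : ∀ {c ℓ} (R : CommutativeRing c ℓ) → ℕ → CommutativeRing.Carrier R
ringFromℕ R zero    = CommutativeRing.0# R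
ringFromℕ R (suc n) = CommutativeRing._+_ R (CommutativeRing.1# R) (ringFromℕ R n)

record CharZeroField c ℓ : Set (lsuc (c ⊔ ℓ)) where
  field
    ring       : CommutativeRing c ℓ
    _⁻¹        : CommutativeRing.Carrier ring → CommutativeRing.Carrier ring
    ⁻¹-inverse : ∀ x → ¬ (CommutativeRing._≈_ ring x (CommutativeRing.0# ring))
               → CommutativeRing._≈_ ring (CommutativeRing._*_ ring x (x ⁻¹))
                                          (CommutativeRing.1# ring)
    charZero   : ∀ n → ¬ (CommutativeRing._≈_ ring (ringFromℕ ring (suc n))
                                                   (CommutativeRing.0# ring))
  open CommutativeRing ring public hiding (ring)

record Graph (n : ℕ) : Set where
  field
    adj     : Fin n → Fin n → Bool
    sym     : ∀ u v → adj u v ≡ adj v u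
    irrefl  : ∀ v → adj v v ≡ false
open Graph public

data Reachable {n : ℕ} (G : Graph n) : Fin n → Fin n → Set where
  here : ∀ {v} → Reachable G v v
  step : ∀ {u w v} → T (adj G u w) → Reachable G w v → Reachable G u v

Connected : ∀ {n} → Graph n → Set
Connected G = ∀ u v → Reachable G u v

-- G2 has vertex set Fin (suc m); the
-- vertex set of the 1-sum is Fin (n1 +ℕ m): the first n1 vertices are
-- those of G1 (with x1 playing the role of the glued vertex y), the
-- last m are the vertices of G2 other than x2, via punchIn x2.

sumAdj : ∀ {n1 m} → Graph n1 → Fin n1 → Graph (suc m) → Fin (suc m)
       → Fin n1 ⊎ Fin m → Fin n1 ⊎ Fin m → Bool
sumAdj G1 x1 G2 x2 (inj₁ i) (inj₁ j) = adj G1 i j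
sumAdj G1 x1 G2 x2 (inj₂ i) (inj₂ j) = adj G2 (punchIn x2 i) (punchIn x2 j)
sumAdj G1 x1 G2 x2 (inj₁ i) (inj₂ j) with i ≟ x1
... | yes _ = adj G2 x2 (punchIn x2 j)
... | no  _ = false
sumAdj G1 x1 G2 x2 (inj₂ i) (inj₁ j) with j ≟ x1
... | yes _ = adj G2 (punchIn x2 i) x2
... | no  _ = false

oneSumAdj : ∀ {n1 m} → Graph n1 → Fin n1 → Graph (suc m) → Fin (suc m)
          → Fin (n1 +ℕ m) → Fin (n1 +ℕ m) → Bool
oneSumAdj {n1} G1 x1 G2 x2 u v = sumAdj G1 x1 G2 x2 (splitAt n1 u) (splitAt n1 v)

private
  sumAdj-sym : ∀ {n1 m} (G1 : Graph n1) x1 (G2 : Graph (suc m)) x2 a b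
             → sumAdj G1 x1 G2 x2 a b ≡ sumAdj G1 x1 G2 x2 b a
  sumAdj-sym G1 x1 G2 x2 (inj₁ i) (inj₁ j) = sym G1 i j
  sumAdj-sym G1 x1 G2 x2 (inj₂ i) (inj₂ j) = sym G2 (punchIn x2 i) (punchIn x2 j)
  sumAdj-sym G1 x1 G2 x2 (inj₁ i) (inj₂ j) with i ≟ x1
  ... | yes _ = sym G2 x2 (punchIn x2 j)
  ... | no  _ = Relation.Binary.PropositionalEquality.refl
  sumAdj-sym G1 x1 G2 x2 (inj₂ i) (inj₁ j) with j ≟ x1
  ... | yes _ = sym G2 (punchIn x2 i) x2
  ... | no  _ = Relation.Binary.PropositionalEquality.refl

  sumAdj-irrefl : ∀ {n1 m} (G1 : Graph n1) x1 (G2 : Graph (suc m)) x2 a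
                → sumAdj G1 x1 G2 x2 a a ≡ false
  sumAdj-irrefl G1 x1 G2 x2 (inj₁ i) = irrefl G1 i
  sumAdj-irrefl G1 x1 G2 x2 (inj₂ i) = irrefl G2 (punchIn x2 i)

oneSum : ∀ {n1 m} → Graph n1 → Fin n1 → Graph (suc m) → Fin (suc m)
       → Graph (n1 +ℕ m)
oneSum {n1} G1 x1 G2 x2 = record
  { adj    = oneSumAdj G1 x1 G2 x2
  ; sym    = λ u v → sumAdj-sym G1 x1 G2 x2 (splitAt n1 u) (splitAt n1 v)
  ; irrefl = λ v → sumAdj-irrefl G1 x1 G2 x2 (splitAt n1 v)
  }

module _ {c ℓ} (F : CharZeroField c ℓ) where
  open CharZeroField F using (Carrier; _≈_; 0#; 1#; _+_; _*_; _-_; _⁻¹)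

  sumFin : ∀ n → (Fin n → Carrier) → Carrier
  sumFin zero    f = 0#
  sumFin (suc n) f = f zero + sumFin n (λ i → f (suc i))

  degree : ∀ {n} → Graph n → Fin n → Carrier
  degree {n} G v = sumFin n (λ w → if adj G v w then 1# else 0#)

  normLaplacian : ∀ {n} → Graph n → (Fin n → Carrier) → Fin n → Carrier
  normLaplacian {n} G f v =
    f v - (degree G v ⁻¹) * sumFin n (λ w → if adj G v w then f w else 0#)

  IsEigenfunction : ∀ {n} → Graph n → Carrier → (Fin n → Carrier) → Set ℓ
  IsEigenfunction {n} G λ' f =
    (∃ λ v → ¬ (f v ≈ 0#)) × (∀ v → normLaplacian G f v ≈ λ' * f v)

  -- f¹ ⊕_{x1,x2} f² on the 1-sum; requires (conceptually) f¹ x1 = f² x2,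
  -- the glued vertex takes the value f¹ x1.
  oneSumFun : ∀ {n1 m} → Fin (suc m) → (Fin n1 → Carrier) → (Fin (suc m) → Carrier)
            → Fin (n1 +ℕ m) → Carrier
  oneSumFun {n1} x2 f1 f2 u with splitAt n1 u
  ... | inj₁ i = f1 i
  ... | inj₂ j = f2 (punchIn x2 j)

  zeroFun : ∀ {n} → Fin n → Carrier
  zeroFun _ = 0#

-- At a vertex of G1 other than x1 the 1-sum changes neither the degree, nor the neighbours, nor
-- the values of f1⊕0, so the eigen-equation of f1 carries over.  At every other vertex f1⊕0
-- vanishes and so does its neighbour sum: at a vertex of G2 because its only possible
-- G1-neighbour is x1, where f1 vanishes; at the glued vertex because there the eigen-equation of
-- f1 reads 0 - deg(x1)⁻¹ · Σ_{w∼x1} f1 w = λ · 0.  So the degrees of G2 never matter, and G2 need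
-- not be connected.  Since the inverse is only specified on nonzero elements, G1 must have no
-- isolated vertex; this follows from its connectivity, as f1 vanishes at x1 but not everywhere.
module Submission where

open import Defs hiding (sym)
open import Data.Nat using (ℕ; zero; suc) renaming (_+_ to _+ℕ_)
open import Data.Fin using (Fin; zero; suc; splitAt; punchIn; _↑ˡ_; _≟_)
open import Data.Fin.Properties using (splitAt-↑ˡ)
open import Data.Bool using (Bool; true; false; if_then_else_; T)
open import Data.Sum using (_⊎_; inj₁; inj₂; [_,_]; map₁)
open import Data.Product using (∃; _,_; proj₂)
open import Data.Empty using (⊥-elim)
open import Function using (_∘_)
open import Relation.Nullary using (¬_; yes; no)
open import Relation.Binary.PropositionalEquality as ≡ using (_≡_; _≢_; cong)
open import Algebra.Bundles using (CommutativeRing)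
import Algebra.Properties.Ring as RingProperties

oneSumFun-splitAt : ∀ {c ℓ} (F : CharZeroField c ℓ) {n1 m} (x2 : Fin (suc m))
                    (f1 : Fin n1 → CharZeroField.Carrier F) f2 u
                  → oneSumFun F x2 f1 f2 u ≡ [ f1 , f2 ∘ punchIn x2 ] (splitAt n1 u)
oneSumFun-splitAt F {n1} x2 f1 f2 u with splitAt n1 u
... | inj₁ i = ≡.refl
... | inj₂ j = ≡.refl

oneSumFun-↑ˡ : ∀ {c ℓ} (F : CharZeroField c ℓ) {n1 m} (x2 : Fin (suc m))
               (f1 : Fin n1 → CharZeroField.Carrier F) f2 i
             → oneSumFun F x2 f1 f2 (i ↑ˡ m) ≡ f1 i
oneSumFun-↑ˡ F {n1} {m} x2 f1 f2 i rewrite splitAt-↑ˡ n1 i m = ≡.refl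

reachable-neighbour : ∀ {n} {G : Graph n} {u v} → Reachable G u v → u ≢ v
                    → ∃ λ w → T (adj G u w)
reachable-neighbour here              u≢u = ⊥-elim (u≢u ≡.refl)
reachable-neighbour (step {w = w} t _) _  = w , t

module _ {c ℓ} (F : CharZeroField c ℓ) where
  open CharZeroField F hiding (zero)
  open RingProperties (CommutativeRing.ring ring) using (x∙y⁻¹≈ε⇒x≈y; x≈y⇒x∙y⁻¹≈ε)
  open import Relation.Binary.Reasoning.Setoid setoid

  ⁻¹-cong : ∀ {x y} → x ≈ y → ¬ y ≈ 0# → x ⁻¹ ≈ y ⁻¹
  ⁻¹-cong {x} {y} x≈y y≉0 = begin
    x ⁻¹               ≈⟨ *-identityʳ _ ⟨
    x ⁻¹ * 1#          ≈⟨ *-congˡ (⁻¹-inverse y y≉0) ⟨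
    x ⁻¹ * (y * y ⁻¹)  ≈⟨ *-assoc _ _ _ ⟨
    (x ⁻¹ * y) * y ⁻¹  ≈⟨ *-congʳ (*-congˡ x≈y) ⟨
    (x ⁻¹ * x) * y ⁻¹  ≈⟨ *-congʳ (*-comm _ _) ⟩
    (x * x ⁻¹) * y ⁻¹  ≈⟨ *-congʳ (⁻¹-inverse x (y≉0 ∘ trans (sym x≈y))) ⟩
    1# * y ⁻¹          ≈⟨ *-identityˡ _ ⟩
    y ⁻¹               ∎

  x⁻¹*y≈0⇒y≈0 : ∀ {x y} → ¬ x ≈ 0# → x ⁻¹ * y ≈ 0# → y ≈ 0#
  x⁻¹*y≈0⇒y≈0 {x} {y} x≉0 x⁻¹y≈0 = begin
    y                ≈⟨ *-identityˡ y ⟨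
    1# * y           ≈⟨ *-congʳ (⁻¹-inverse x x≉0) ⟨
    (x * x ⁻¹) * y   ≈⟨ *-assoc _ _ _ ⟩
    x * (x ⁻¹ * y)   ≈⟨ *-congˡ x⁻¹y≈0 ⟩
    x * 0#           ≈⟨ zeroʳ x ⟩
    0#               ∎

  if-then-else≈0# : ∀ b {x} → x ≈ 0# → (if b then x else 0#) ≈ 0#
  if-then-else≈0# true  x≈0 = x≈0
  if-then-else≈0# false _   = refl

  sumFin-cong : ∀ {n} {f g : Fin n → Carrier} → (∀ i → f i ≈ g i) → sumFin F n f ≈ sumFin F n g
  sumFin-cong {zero}  f≈g = refl
  sumFin-cong {suc n} f≈g = +-cong (f≈g zero) (sumFin-cong (f≈g ∘ suc))

  sumFin-≈0 : ∀ {n} {f : Fin n → Carrier} → (∀ i → f i ≈ 0#) → sumFin F n f ≈ 0#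
  sumFin-≈0 {zero}  f≈0 = refl
  sumFin-≈0 {suc n} f≈0 = trans (+-cong (f≈0 zero) (sumFin-≈0 (f≈0 ∘ suc))) (+-identityˡ 0#)

  sumFin-splitAt : ∀ n1 m (H : Fin n1 ⊎ Fin m → Carrier)
                 → sumFin F (n1 +ℕ m) (H ∘ splitAt n1)
                   ≈ sumFin F n1 (H ∘ inj₁) + sumFin F m (H ∘ inj₂)
  sumFin-splitAt zero     m H = sym (+-identityˡ _)
  sumFin-splitAt (suc n1) m H =
    trans (+-congˡ (sumFin-splitAt n1 m (H ∘ map₁ suc))) (sym (+-assoc _ _ _))

  sumFin-indicator : ∀ n (b : Fin n → Bool)
                   → ∃ λ k → sumFin F n (λ v → if b v then 1# else 0#) ≈ ringFromℕ ring k
  sumFin-indicator zero    b = 0 , refl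
  sumFin-indicator (suc n) b with b zero | sumFin-indicator n (b ∘ suc)
  ... | true  | k , e = suc k , +-congˡ e
  ... | false | k , e = k , trans (+-identityˡ _) e

  sumFin-indicator-suc : ∀ n (b : Fin n → Bool) w → T (b w)
                       → ∃ λ k → sumFin F n (λ v → if b v then 1# else 0#) ≈ ringFromℕ ring (suc k)
  sumFin-indicator-suc (suc n) b zero bw with b zero
  ... | true = let k , e = sumFin-indicator n (b ∘ suc) in k , +-congˡ e
  sumFin-indicator-suc (suc n) b (suc w) bw with b zero
  ... | true  = let k , e = sumFin-indicator n (b ∘ suc) in k , +-congˡ e
  ... | false = let k , e = sumFin-indicator-suc n (b ∘ suc) w bw in k , trans (+-identityˡ _) e

  -- Definitionally, degree G v is neighbourSum G (λ _ → 1#) v and normLaplacian G f v is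
  -- f v - degree G v ⁻¹ * neighbourSum G f v.
  neighbourSum : ∀ {n} → Graph n → (Fin n → Carrier) → Fin n → Carrier
  neighbourSum {n} G f v = sumFin F n (λ w → if adj G v w then f w else 0#)

  neighbourSum-cong : ∀ {n} (G : Graph n) {f g : Fin n → Carrier} {v}
                    → (∀ w → f w ≡ g w) → neighbourSum G f v ≈ neighbourSum G g v
  neighbourSum-cong G {v = v} f≡g =
    sumFin-cong (λ w → reflexive (cong (λ x → if adj G v w then x else 0#) (f≡g w)))

  degree≉0 : ∀ {n} (G : Graph n) {v w} → T (adj G v w) → ¬ degree F G v ≈ 0#
  degree≉0 {n} G {v} {w} vw deg≈0 =
    let k , deg≈k = sumFin-indicator-suc n (adj G v) w vw in charZero k (trans (sym deg≈k) deg≈0)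

  connected⇒degree≉0 : ∀ {n} {G : Graph n} → Connected G → ∀ {u v} → u ≢ v
                     → ∀ w → ¬ degree F G w ≈ 0#
  connected⇒degree≉0 {G = G} connected {u} {v} u≢v w with w ≟ u
  ... | yes ≡.refl = degree≉0 G (proj₂ (reachable-neighbour (connected w v) u≢v))
  ... | no w≢u     = degree≉0 G (proj₂ (reachable-neighbour (connected w u) w≢u))

  normLaplacian-cong : ∀ {n n'} (G : Graph n) (G' : Graph n') {f f' v v'}
                     → f v ≈ f' v' → degree F G v ≈ degree F G' v' → ¬ degree F G' v' ≈ 0#
                     → neighbourSum G f v ≈ neighbourSum G' f' v'
                     → normLaplacian F G f v ≈ normLaplacian F G' f' v'
  normLaplacian-cong _ _ fv≈ deg≈ deg≉0 sum≈ =
    +-cong fv≈ (-‿cong (*-cong (⁻¹-cong deg≈ deg≉0) sum≈))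

  eigen-at-zero : ∀ {n} (G : Graph n) {f v} λ' → f v ≈ 0# → neighbourSum G f v ≈ 0#
                → normLaplacian F G f v ≈ λ' * f v
  eigen-at-zero G {v = v} λ' fv≈0 sum≈0 = begin
    normLaplacian F G _ v  ≈⟨ x≈y⇒x∙y⁻¹≈ε (trans fv≈0 (sym (trans (*-congˡ sum≈0) (zeroʳ _)))) ⟩
    0#                     ≈⟨ zeroʳ λ' ⟨
    λ' * 0#                ≈⟨ *-congˡ fv≈0 ⟨
    λ' * _                 ∎

  eigen-at-zero⇒neighbourSum≈0 : ∀ {n} (G : Graph n) {f v λ'} → normLaplacian F G f v ≈ λ' * f v
                               → f v ≈ 0# → ¬ degree F G v ≈ 0# → neighbourSum G f v ≈ 0#
  eigen-at-zero⇒neighbourSum≈0 G {λ' = λ'} eigen fv≈0 deg≉0 = x⁻¹*y≈0⇒y≈0 deg≉0 (begin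
    _   ≈⟨ x∙y⁻¹≈ε⇒x≈y _ _ (trans eigen (trans (*-congˡ fv≈0) (zeroʳ λ'))) ⟨
    _   ≈⟨ fv≈0 ⟩
    0#  ∎)

  module _ {n1 m} (G1 : Graph n1) (x1 : Fin n1) (G2 : Graph (suc m)) (x2 : Fin (suc m)) where

    splitNeighbourSum : (Fin n1 ⊎ Fin m → Carrier) → Fin n1 ⊎ Fin m → Carrier
    splitNeighbourSum H a =
      sumFin F n1 (λ i → if sumAdj G1 x1 G2 x2 a (inj₁ i) then H (inj₁ i) else 0#)
      + sumFin F m (λ j → if sumAdj G1 x1 G2 x2 a (inj₂ j) then H (inj₂ j) else 0#)

    neighbourSum-oneSum : ∀ H {u a} → splitAt n1 u ≡ a
                        → neighbourSum (oneSum G1 x1 G2 x2) (H ∘ splitAt n1) u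
                          ≈ splitNeighbourSum H a
    neighbourSum-oneSum H {u} ≡.refl =
      sumFin-splitAt n1 m (λ s → if sumAdj G1 x1 G2 x2 (splitAt n1 u) s then H s else 0#)

    splitNeighbourSum-inj₁ : ∀ H {i}
                           → (∀ j → (if sumAdj G1 x1 G2 x2 (inj₁ i) (inj₂ j) then H (inj₂ j) else 0#)
                                    ≈ 0#)
                           → splitNeighbourSum H (inj₁ i) ≈ neighbourSum G1 (H ∘ inj₁) i
    splitNeighbourSum-inj₁ H G2-part≈0 = trans (+-congˡ (sumFin-≈0 G2-part≈0)) (+-identityʳ _)

    degree-oneSum : ∀ {u i} → splitAt n1 u ≡ inj₁ i → i ≢ x1
                  → degree F (oneSum G1 x1 G2 x2) u ≈ degree F G1 i
    degree-oneSum {i = i} u↦i i≢x1 =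
      trans (neighbourSum-oneSum (λ _ → 1#) u↦i) (splitNeighbourSum-inj₁ (λ _ → 1#) no-G2-neighbour)
      where
      no-G2-neighbour : ∀ j → (if sumAdj G1 x1 G2 x2 (inj₁ i) (inj₂ j) then 1# else 0#) ≈ 0#
      no-G2-neighbour j with i ≟ x1
      ... | yes i≡x1 = ⊥-elim (i≢x1 i≡x1)
      ... | no _     = refl

    module _ (f1 : Fin n1 → Carrier) where

      private
        f1⊕0 : Fin (n1 +ℕ m) → Carrier
        f1⊕0 = oneSumFun F x2 f1 (zeroFun F)

        f1⊎0 : Fin n1 ⊎ Fin m → Carrier
        f1⊎0 = [ f1 , (λ _ → 0#) ]

      f1⊕0≡f1⊎0 : ∀ {u a} → splitAt n1 u ≡ a → f1⊕0 u ≡ f1⊎0 a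
      f1⊕0≡f1⊎0 {u} u↦a = ≡.trans (oneSumFun-splitAt F x2 f1 (zeroFun F) u) (cong f1⊎0 u↦a)

      neighbourSum-f1⊕0 : ∀ {u a} → splitAt n1 u ≡ a
                        → neighbourSum (oneSum G1 x1 G2 x2) f1⊕0 u ≈ splitNeighbourSum f1⊎0 a
      neighbourSum-f1⊕0 u↦a =
        trans (neighbourSum-cong (oneSum G1 x1 G2 x2) (oneSumFun-splitAt F x2 f1 (zeroFun F)))
              (neighbourSum-oneSum f1⊎0 u↦a)

      splitNeighbourSum-f1⊎0-inj₁ : ∀ i → splitNeighbourSum f1⊎0 (inj₁ i) ≈ neighbourSum G1 f1 i
      splitNeighbourSum-f1⊎0-inj₁ i = splitNeighbourSum-inj₁ f1⊎0 (λ j → if-then-else≈0# _ refl)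

      splitNeighbourSum-f1⊎0-inj₂ : f1 x1 ≈ 0# → ∀ j → splitNeighbourSum f1⊎0 (inj₂ j) ≈ 0#
      splitNeighbourSum-f1⊎0-inj₂ f1x1≈0 j =
        trans (+-cong (sumFin-≈0 G1-part≈0) (sumFin-≈0 G2-part≈0)) (+-identityʳ 0#)
        where
        G2-part≈0 : ∀ j' → (if sumAdj G1 x1 G2 x2 (inj₂ j) (inj₂ j') then 0# else 0#) ≈ 0#
        G2-part≈0 j' = if-then-else≈0# _ refl

        G1-part≈0 : ∀ i → (if sumAdj G1 x1 G2 x2 (inj₂ j) (inj₁ i) then f1 i else 0#) ≈ 0#
        G1-part≈0 i with i ≟ x1
        ... | yes ≡.refl = if-then-else≈0# _ f1x1≈0
        ... | no _       = refl

      oneSum-eigen : ∀ λ' → (∀ i → ¬ degree F G1 i ≈ 0#)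
                   → (∀ i → normLaplacian F G1 f1 i ≈ λ' * f1 i) → f1 x1 ≈ 0#
                   → ∀ u → normLaplacian F (oneSum G1 x1 G2 x2) f1⊕0 u ≈ λ' * f1⊕0 u
      oneSum-eigen λ' deg≉0 eigen f1x1≈0 u = at-side (splitAt n1 u) ≡.refl
        where
        G : Graph (n1 +ℕ m)
        G = oneSum G1 x1 G2 x2

        at-side : ∀ a → splitAt n1 u ≡ a → normLaplacian F G f1⊕0 u ≈ λ' * f1⊕0 u
        at-side (inj₂ j) u↦j = eigen-at-zero G λ' (reflexive (f1⊕0≡f1⊎0 u↦j))
          (trans (neighbourSum-f1⊕0 u↦j) (splitNeighbourSum-f1⊎0-inj₂ f1x1≈0 j))
        at-side (inj₁ i) u↦i with i ≟ x1
        ... | yes ≡.refl = eigen-at-zero G λ' (trans (reflexive (f1⊕0≡f1⊎0 u↦i)) f1x1≈0)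
          (trans (neighbourSum-f1⊕0 u↦i) (trans (splitNeighbourSum-f1⊎0-inj₁ x1)
            (eigen-at-zero⇒neighbourSum≈0 G1 (eigen x1) f1x1≈0 (deg≉0 x1))))
        ... | no i≢x1 = begin
          normLaplacian F G f1⊕0 u  ≈⟨ normLaplacian-cong G G1 value (degree-oneSum u↦i i≢x1) (deg≉0 i)
                                         (trans (neighbourSum-f1⊕0 u↦i)
                                                (splitNeighbourSum-f1⊎0-inj₁ i)) ⟩
          normLaplacian F G1 f1 i   ≈⟨ eigen i ⟩
          λ' * f1 i                 ≈⟨ *-congˡ value ⟨
          λ' * f1⊕0 u               ∎
          where
          value : f1⊕0 u ≈ f1 i
          value = reflexive (f1⊕0≡f1⊎0 u↦i)

proposition5p10 : ∀ {c ℓ} (F : CharZeroField c ℓ) {n1 m : ℕ}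
    (G1 : Graph n1) (G2 : Graph (suc m)) (x1 : Fin n1) (x2 : Fin (suc m))
    → Connected G1 → Connected G2
    → (λ' : CharZeroField.Carrier F) (f1 : Fin n1 → CharZeroField.Carrier F)
    → IsEigenfunction F G1 λ' f1
    → CharZeroField._≈_ F (f1 x1) (CharZeroField.0# F)
    → IsEigenfunction F (oneSum G1 x1 G2 x2) λ' (oneSumFun F x2 f1 (zeroFun F))
proposition5p10 F {n1} {m} G1 G2 x1 x2 G1-connected _ λ' f1 ((v , f1v≉0) , eigen) f1x1≈0 =
  (v ↑ˡ m , f1⊕0[v]≉0) , oneSum-eigen F G1 x1 G2 x2 f1 λ' deg≉0 eigen f1x1≈0
  where
  open CharZeroField F using (_≈_; 0#)

  v≢x1 : v ≢ x1
  v≢x1 ≡.refl = f1v≉0 f1x1≈0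

  deg≉0 : ∀ i → ¬ degree F G1 i ≈ 0#
  deg≉0 = connected⇒degree≉0 F G1-connected v≢x1

  f1⊕0[v]≉0 : ¬ oneSumFun F x2 f1 (zeroFun F) (v ↑ˡ m) ≈ 0#
  f1⊕0[v]≉0 rewrite oneSumFun-↑ˡ F x2 f1 (zeroFun F) v = f1v≉0
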